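{- Let $f$ be an $\mathsf{A}$-shop on a finite set $B$ with $|B|\geq 2$. Then $\langle f\rangle$ contains an $\mathsf{A}$-shop $g$ for which there are an element $b\in B$ and sets $B',B''$ such that $\{b\},B',B''$ are pairwise disjoint with union $B$, $B'$ is non-empty, and (1) $g(b)=B$; (2) $g(x)=\{x\}$ for all $x\in B'$; (3) for every $x\in B''$ there is $y\in B'$ with $g(x)=\{y\}$.
   Context: A shop on a finite set $B$ is a map $f:B\to\mathfrak{P}(B)\setminus\{\emptyset\}$ such that every $y\in B$ lies in $f(x)$ for some $x\in B$. $f$ is an $\mathsf{A}$-shop if there is $b\in B$ with $f(b)=B$. The identity shop is $x\mapsto\{x\}$; the composition of shops is $(g\circ f)(x)=\{z:\exists y\,(y\in f(x)\wedge z\in g(y))\}$; $f$ is a sub-shop of $g$ if $f(x)\subseteq g(x)$ for all $x$. A down-she-monoid is a set of shops on $B$ containing the identity and closed under composition and under taking sub-shops (that are themselves shops). $\langle f\rangle$ denotes the smallest down-she-monoid containing $f$. -}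

module Defs where

open import Data.Nat using (ℕ; zero; suc)
open import Data.Bool using (Bool; false; _∧_; _∨_)
open import Data.Fin using (Fin; zero; suc)
open import Data.Fin.Subset using (Subset; _∈_; _⊆_; ⁅_⁆; ⊤; Nonempty)
open import Data.Vec using (tabulate; lookup)
open import Data.Product using (Σ; _×_; ∃)
open import Relation.Binary.PropositionalEquality using (_≡_)

ShopMap : ℕ → Set
ShopMap n = Fin n → Subset n

IsShop : ∀ {n} → ShopMap n → Set
IsShop {n} f = (∀ x → Nonempty (f x)) × (∀ (y : Fin n) → ∃ λ x → y ∈ f x)

IsAShop : ∀ {n} → ShopMap n → Set
IsAShop {n} f = IsShop f × ∃ λ (b : Fin n) → f b ≡ ⊤

anyFin : ∀ {n} → (Fin n → Bool) → Bool
anyFin {zero}  p = false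
anyFin {suc n} p = p zero ∨ anyFin (λ i → p (suc i))

idShop : ∀ {n} → ShopMap n
idShop x = ⁅ x ⁆

-- composition (g ∘ f)(x) = { z : ∃ y, y ∈ f(x) ∧ z ∈ g(y) }
_⊙_ : ∀ {n} → ShopMap n → ShopMap n → ShopMap n
(g ⊙ f) x = tabulate λ z → anyFin λ y → lookup (f x) y ∧ lookup (g y) z

SubShop : ∀ {n} → ShopMap n → ShopMap n → Set
SubShop f g = ∀ x → f x ⊆ g x

record IsDownSheMonoid {n} (M : ShopMap n → Set) : Set where
  field
    onlyShops : ∀ f → M f → IsShop f
    hasId     : M idShop
    closed⊙   : ∀ f g → M f → M g → M (g ⊙ f)
    closed⊆   : ∀ f g → M g → IsShop f → SubShop f g → M f

-- ⟨ f ⟩ : the smallest down-she-monoid containing f, i.e. the intersection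
-- of all down-she-monoids containing f.
_∈⟨_⟩ : ∀ {n} → ShopMap n → ShopMap n → Set₁
g ∈⟨ f ⟩ = ∀ (M : ShopMap _ → Set) → IsDownSheMonoid M → M f → M g

-- Pick s x ∈ f x.  With K = (|B| + 1)!, the map e = s^K is idempotent, because
-- every eventual period of s divides K; moreover s^j x ∈ f^j x.  Since f b = B,
-- as soon as b ∈ f^j x all later powers of f send x to B.  So the shop g with
-- g b = B, g x = {x} if e x = b, and g x = {e x} otherwise, is a sub-shop of
-- f^(2K) and hence lies in ⟨ f ⟩.  B′ consists of the x ≠ b with g x = {x}, and
-- every other x ≠ b is sent by g to e x ∈ B′.
module Submission where

open import Defs
open import Data.Nat using (ℕ; _≤_)
open import Data.Fin using (Fin)
open import Data.Fin.Subset using (Subset; _∈_; _∉_; _∩_; _∪_; ⁅_⁆; ⊤; Nonempty; Empty)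
open import Data.Product using (Σ; ∃; _×_)
open import Relation.Binary.PropositionalEquality using (_≡_)

open import Data.Bool using (Bool; true; _∧_)
open import Data.Bool.Properties using (∨-zeroʳ)
open import Data.Fin as Fin using (toℕ; punchIn)
open import Data.Fin.Properties using (pigeonhole; toℕ<n; punchInᵢ≢i) renaming (_≟_ to _≟ᶠ_)
open import Data.Fin.Subset using (∁)
open import Data.Fin.Subset.Properties
  using (∈⊤; ⊆⊤; ⊆-antisym; x∈⁅x⁆; x∈⁅y⁆⇒x≡y; x∈p∪q⁺; x∈p∩q⁻; x∈∁p⇒x∉p; p∪∁p≡⊤; ∪-assoc)
open import Data.Nat using (zero; suc; _+_; _*_; _∸_; _<_; _≤′_; ≤′-refl; ≤′-step; s≤s; z≤n; _!)
open import Data.Nat.Divisibility using (_∣_; m∣m*n; ∣-trans; m≤n⇒m!∣n!; ∣⇒≤)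
open import Data.Nat.GeneralisedArithmetic using (fold; fold-+)
open import Data.Nat.Properties
  using (+-comm; ≤-refl; ≤-trans; <⇒≤; n<1+n; m∸n≤m; m∸n+n≡m; m<n⇒0<n∸m; m≤m+n; m<m+n; ≤⇒≤′; 1≤n!; _!≢0)
open import Data.Product using (_,_; proj₁; proj₂; ∃₂)
open import Data.Sum using (inj₁; inj₂)
open import Data.Vec using (tabulate; lookup)
open import Data.Vec.Properties using (lookup⇒[]=; []=⇒lookup; lookup∘tabulate)
open import Function using (_∘_)
open import Relation.Nullary using (Dec; yes; no; does; contradiction)
open import Relation.Nullary.Decidable using (dec-true; ¬?; _×-dec_)
open import Relation.Unary using (Pred; Decidable)
open import Relation.Binary.PropositionalEquality
  using (_≢_; refl; sym; trans; cong; cong₂; subst; module ≡-Reasoning)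

open ≡-Reasoning

fold-periodic-* : ∀ {a} {A : Set a} (s : A → A) {y d} →
                  fold y s d ≡ y → ∀ q → fold y s (q * d) ≡ y
fold-periodic-* s         period zero    = refl
fold-periodic-* s {y} {d} period (suc q) = begin
  fold y s (d + q * d)        ≡⟨ fold-+ y s d ⟩
  fold (fold y s (q * d)) s d ≡⟨ cong (λ z → fold z s d) (fold-periodic-* s period q) ⟩
  fold y s d                  ≡⟨ period ⟩
  y                           ∎

fold-periodic-orbit : ∀ {a} {A : Set a} (s : A → A) {y d} →
                      fold y s d ≡ y → ∀ m → fold (fold y s m) s d ≡ fold y s m
fold-periodic-orbit s {y} {d} period m = begin
  fold (fold y s m) s d ≡⟨ fold-+ y s d ⟨
  fold y s (d + m)      ≡⟨ cong (fold y s) (+-comm d m) ⟩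
  fold y s (m + d)      ≡⟨ fold-+ y s m ⟩
  fold (fold y s d) s m ≡⟨ cong (λ z → fold z s m) period ⟩
  fold y s m            ∎

fold-eventually-periodic : ∀ {n} (s : Fin n → Fin n) x →
  ∃₂ λ i d → i < suc n × 0 < d × d ≤ suc n × fold (fold x s i) s d ≡ fold x s i
fold-eventually-periodic {n} s x
  with i , j , i<j , same ← pigeonhole (n<1+n n) (fold x s ∘ toℕ)
  = toℕ i , toℕ j ∸ toℕ i , toℕ<n i , m<n⇒0<n∸m i<j
  , ≤-trans (m∸n≤m (toℕ j) (toℕ i)) (<⇒≤ (toℕ<n j))
  , (begin
      fold (fold x s (toℕ i)) s (toℕ j ∸ toℕ i) ≡⟨ fold-+ x s (toℕ j ∸ toℕ i) ⟨
      fold x s (toℕ j ∸ toℕ i + toℕ i)          ≡⟨ cong (fold x s) (m∸n+n≡m (<⇒≤ i<j)) ⟩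
      fold x s (toℕ j)                          ≡⟨ same ⟨
      fold x s (toℕ i)                          ∎)

0<m≤n⇒m∣n! : ∀ {m n} → 0 < m → m ≤ n → m ∣ n !
0<m≤n⇒m∣n! {suc m} _ m≤n = ∣-trans (m∣m*n (m !)) (m≤n⇒m!∣n! m≤n)

fold-!-idempotent : ∀ {n} (s : Fin n → Fin n) x →
                    fold (fold x s (suc n !)) s (suc n !) ≡ fold x s (suc n !)
fold-!-idempotent {n} s x
  with i , d , i<1+n , 0<d , d≤1+n , period ← fold-eventually-periodic s x
  = begin
    fold z s K       ≡⟨ cong (fold z s) (_∣_.equality d∣K) ⟩
    fold z s (q * d) ≡⟨ fold-periodic-* s z-periodic q ⟩
    z                ∎
  where
  K = suc n !
  z = fold x s K
  d∣K : d ∣ K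
  d∣K = 0<m≤n⇒m∣n! 0<d d≤1+n
  q = _∣_.quotient d∣K
  i≤K : i ≤ K
  i≤K = ≤-trans (<⇒≤ i<1+n) (∣⇒≤ {{suc n !≢0}} (0<m≤n⇒m∣n! (s≤s z≤n) ≤-refl))
  z-on-orbit : z ≡ fold (fold x s i) s (K ∸ i)
  z-on-orbit = trans (cong (fold x s) (sym (m∸n+n≡m i≤K))) (fold-+ x s (K ∸ i))
  z-periodic : fold z s d ≡ z
  z-periodic = subst (λ w → fold w s d ≡ w) (sym z-on-orbit)
                     (fold-periodic-orbit s {d = d} period (K ∸ i))

toSubset : ∀ {n ℓ} {P : Pred (Fin n) ℓ} → Decidable P → Subset n
toSubset P? = tabulate (does ∘ P?)

∈-toSubset⁺ : ∀ {n ℓ} {P : Pred (Fin n) ℓ} (P? : Decidable P) {x} → P x → x ∈ toSubset P?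
∈-toSubset⁺ P? {x} px = lookup⇒[]= x _ (trans (lookup∘tabulate (does ∘ P?) x) (dec-true (P? x) px))

∈-toSubset⁻ : ∀ {n ℓ} {P : Pred (Fin n) ℓ} (P? : Decidable P) {x} → x ∈ toSubset P? → P x
∈-toSubset⁻ P? {x} x∈ with P? x | trans (sym (lookup∘tabulate (does ∘ P?) x)) ([]=⇒lookup x∈)
... | yes px | _ = px
... | no _   | ()

∀∈⇒≡⊤ : ∀ {n} {p : Subset n} → (∀ x → x ∈ p) → p ≡ ⊤
∀∈⇒≡⊤ all∈ = ⊆-antisym ⊆⊤ (λ {x} _ → all∈ x)

anyFin⁺ : ∀ {n} (p : Fin n → Bool) y → p y ≡ true → anyFin p ≡ true
anyFin⁺ p Fin.zero    py rewrite py = refl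
anyFin⁺ p (Fin.suc y) py rewrite anyFin⁺ (p ∘ Fin.suc) y py = ∨-zeroʳ (p Fin.zero)

∈-⊙ : ∀ {n} (g f : ShopMap n) {x y z} → y ∈ f x → z ∈ g y → z ∈ (g ⊙ f) x
∈-⊙ g f {x} {y} {z} y∈fx z∈gy = lookup⇒[]= z ((g ⊙ f) x) (begin
  lookup ((g ⊙ f) x) z
    ≡⟨ lookup∘tabulate _ z ⟩
  anyFin (λ y′ → lookup (f x) y′ ∧ lookup (g y′) z)
    ≡⟨ anyFin⁺ _ y (cong₂ _∧_ ([]=⇒lookup y∈fx) ([]=⇒lookup z∈gy)) ⟩
  true ∎)

⊙-⊤ : ∀ {n} (g f : ShopMap n) {x y} → y ∈ f x → g y ≡ ⊤ → (g ⊙ f) x ≡ ⊤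
⊙-⊤ g f y∈fx gy≡⊤ = ∀∈⇒≡⊤ (λ z → ∈-⊙ g f y∈fx (subst (z ∈_) (sym gy≡⊤) ∈⊤))

infixr 8 _^_

_^_ : ∀ {n} → ShopMap n → ℕ → ShopMap n
f ^ j = fold idShop (f ⊙_) j

^∈⟨⟩ : ∀ {n} (f : ShopMap n) j → (f ^ j) ∈⟨ f ⟩
^∈⟨⟩ f zero    M isDSM Mf = IsDownSheMonoid.hasId isDSM
^∈⟨⟩ f (suc j) M isDSM Mf = IsDownSheMonoid.closed⊙ isDSM (f ^ j) f (^∈⟨⟩ f j M isDSM Mf) Mf

subShop-∈⟨⟩ : ∀ {n} {f g h : ShopMap n} → IsShop g → SubShop g h → h ∈⟨ f ⟩ → g ∈⟨ f ⟩
subShop-∈⟨⟩ {g = g} {h} g-shop g⊆h h∈ M isDSM Mf =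
  IsDownSheMonoid.closed⊆ isDSM g h (h∈ M isDSM Mf) g-shop g⊆h

fold∈^ : ∀ {n} (f : ShopMap n) {s : Fin n → Fin n} →
         (∀ x → s x ∈ f x) → ∀ j x → fold x s j ∈ (f ^ j) x
fold∈^ f s∈f zero    x = x∈⁅x⁆ x
fold∈^ f s∈f (suc j) x = ∈-⊙ f (f ^ j) (fold∈^ f s∈f j x) (s∈f _)

^-⊤ : ∀ {n} (f : ShopMap n) {b} → f b ≡ ⊤ →
      ∀ {j m x} → b ∈ (f ^ j) x → j < m → (f ^ m) x ≡ ⊤
^-⊤ f {b} fb {j} {x = x} b∈ j<m = go (≤⇒≤′ j<m)
  where
  go : ∀ {m} → suc j ≤′ m → (f ^ m) x ≡ ⊤
  go ≤′-refl                = ⊙-⊤ f (f ^ j) b∈ fb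
  go {suc m} (≤′-step j<m) = ⊙-⊤ f (f ^ m) (subst (b ∈_) (sym (go j<m)) ∈⊤) fb

module Retract {n} (e : Fin n → Fin n) (e-idem : ∀ x → e (e x) ≡ e x) (b : Fin n) where

  retract : Fin n → Fin n
  retract x with e x ≟ᶠ b
  ... | yes _ = x
  ... | no  _ = e x

  retract-≡ : ∀ {x} → e x ≡ b → retract x ≡ x
  retract-≡ {x} ex≡b with e x ≟ᶠ b
  ... | yes _    = refl
  ... | no  ex≢b = contradiction ex≡b ex≢b

  retract-≢ : ∀ {x} → e x ≢ b → retract x ≡ e x
  retract-≢ {x} ex≢b with e x ≟ᶠ b
  ... | yes ex≡b = contradiction ex≡b ex≢b
  ... | no  _    = refl

  retract-idem : ∀ x → retract (retract x) ≡ retract x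
  retract-idem x = cases (e x ≟ᶠ b)
    where
    cases : Dec (e x ≡ b) → retract (retract x) ≡ retract x
    cases (yes ex≡b) = cong retract (retract-≡ ex≡b)
    cases (no  ex≢b) = begin
      retract (retract x) ≡⟨ cong retract (retract-≢ ex≢b) ⟩
      retract (e x)       ≡⟨ retract-≢ (ex≢b ∘ trans (sym (e-idem x))) ⟩
      e (e x)             ≡⟨ e-idem x ⟩
      e x                 ≡⟨ retract-≢ ex≢b ⟨
      retract x           ∎

  retract-≢b : ∀ {x} → x ≢ b → retract x ≢ b
  retract-≢b {x} x≢b = cases (e x ≟ᶠ b)
    where
    cases : Dec (e x ≡ b) → retract x ≢ b
    cases (yes ex≡b) = x≢b ∘ trans (sym (retract-≡ ex≡b))
    cases (no  ex≢b) = ex≢b ∘ trans (sym (retract-≢ ex≢b))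

module Collapse {n} (b : Fin n) (r : Fin n → Fin n)
                (r-idem : ∀ x → r (r x) ≡ r x) (r-≢ : ∀ {x} → x ≢ b → r x ≢ b) where

  collapse : ShopMap n
  collapse x with x ≟ᶠ b
  ... | yes _ = ⊤
  ... | no  _ = ⁅ r x ⁆

  collapse-b : collapse b ≡ ⊤
  collapse-b with b ≟ᶠ b
  ... | yes _   = refl
  ... | no  b≢b = contradiction refl b≢b

  collapse-≢ : ∀ {x} → x ≢ b → collapse x ≡ ⁅ r x ⁆
  collapse-≢ {x} x≢b with x ≟ᶠ b
  ... | yes x≡b = contradiction x≡b x≢b
  ... | no  _   = refl

  collapse-AShop : IsAShop collapse
  collapse-AShop = (nonempty , λ y → b , subst (y ∈_) (sym collapse-b) ∈⊤) , b , collapse-b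
    where
    nonempty : ∀ x → Nonempty (collapse x)
    nonempty x with x ≟ᶠ b
    ... | yes _ = x , ∈⊤
    ... | no  _ = r x , x∈⁅x⁆ (r x)

  collapse-⊆ : (h : ShopMap n) → h b ≡ ⊤ → (∀ x → r x ∈ h x) → SubShop collapse h
  collapse-⊆ h hb r∈h x with x ≟ᶠ b
  ... | yes refl = λ _ → subst (_ ∈_) (sym hb) ∈⊤
  ... | no  _    = λ z∈ → subst (_∈ h x) (sym (x∈⁅y⁆⇒x≡y (r x) z∈)) (r∈h x)

  B′? : Decidable (λ x → x ≢ b × r x ≡ x)
  B′? x = ¬? (x ≟ᶠ b) ×-dec r x ≟ᶠ x

  B′ : Subset n
  B′ = toSubset B′?

  B″ : Subset n
  B″ = ∁ (⁅ b ⁆ ∪ B′)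

  b∉B′ : b ∉ B′
  b∉B′ b∈B′ = proj₁ (∈-toSubset⁻ B′? b∈B′) refl

  b∉B″ : b ∉ B″
  b∉B″ b∈B″ = x∈∁p⇒x∉p b∈B″ (x∈p∪q⁺ (inj₁ (x∈⁅x⁆ b)))

  B′∩B″-empty : Empty (B′ ∩ B″)
  B′∩B″-empty (x , x∈B′∩B″) with x∈B′ , x∈B″ ← x∈p∩q⁻ B′ B″ x∈B′∩B″ =
    x∈∁p⇒x∉p x∈B″ (x∈p∪q⁺ (inj₂ x∈B′))

  b∪B′∪B″≡⊤ : ⁅ b ⁆ ∪ B′ ∪ B″ ≡ ⊤
  b∪B′∪B″≡⊤ = trans (sym (∪-assoc ⁅ b ⁆ B′ B″)) (p∪∁p≡⊤ (⁅ b ⁆ ∪ B′))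

  r∈B′ : ∀ {x} → x ≢ b → r x ∈ B′
  r∈B′ {x} x≢b = ∈-toSubset⁺ B′? (r-≢ x≢b , r-idem x)

  B′-nonempty : ∃ (_≢ b) → Nonempty B′
  B′-nonempty (x , x≢b) = r x , r∈B′ x≢b

  collapse-B′ : ∀ x → x ∈ B′ → collapse x ≡ ⁅ x ⁆
  collapse-B′ x x∈B′ with x≢b , rx≡x ← ∈-toSubset⁻ B′? x∈B′ =
    trans (collapse-≢ x≢b) (cong ⁅_⁆ rx≡x)

  collapse-B″ : ∀ x → x ∈ B″ → ∃ λ y → y ∈ B′ × collapse x ≡ ⁅ y ⁆
  collapse-B″ x x∈B″ = r x , r∈B′ x≢b , collapse-≢ x≢b
    where
    x≢b : x ≢ b
    x≢b refl = b∉B″ x∈B″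

module Construction {n} (f : ShopMap n) (nonempty : ∀ x → Nonempty (f x))
                    (b : Fin n) (fb : f b ≡ ⊤) where

  s : Fin n → Fin n
  s x = proj₁ (nonempty x)

  K : ℕ
  K = suc n !

  e : Fin n → Fin n
  e x = fold x s K

  e-idem : ∀ x → e (e x) ≡ e x
  e-idem = fold-!-idempotent s

  open Retract e e-idem b public
  open Collapse b retract retract-idem retract-≢b public

  0<K : 0 < K
  0<K = 1≤n! (suc n)

  W : ShopMap n
  W = f ^ (K + K)

  W-b : W b ≡ ⊤
  W-b = ^-⊤ f fb (x∈⁅x⁆ b) (≤-trans 0<K (m≤m+n K K))

  retract∈W : ∀ x → retract x ∈ W x
  retract∈W x = cases (e x ≟ᶠ b)
    where
    eex∈W : e (e x) ∈ W x
    eex∈W = subst (_∈ W x) (fold-+ x s K) (fold∈^ f (proj₂ ∘ nonempty) (K + K) x)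
    cases : Dec (e x ≡ b) → retract x ∈ W x
    cases (yes ex≡b) = subst (retract x ∈_) (sym (^-⊤ f fb b∈f^Kx (m<m+n K 0<K))) ∈⊤
      where
      b∈f^Kx : b ∈ (f ^ K) x
      b∈f^Kx = subst (_∈ (f ^ K) x) ex≡b (fold∈^ f (proj₂ ∘ nonempty) K x)
    cases (no ex≢b) = subst (_∈ W x) (trans (e-idem x) (sym (retract-≢ ex≢b))) eex∈W

  collapse∈⟨f⟩ : collapse ∈⟨ f ⟩
  collapse∈⟨f⟩ = subShop-∈⟨⟩ (proj₁ collapse-AShop) (collapse-⊆ W W-b retract∈W) (^∈⟨⟩ f (K + K))

lemma3p5 : (n : ℕ) → 2 ≤ n → (f : ShopMap n) → IsAShop f →
    Σ (ShopMap n) λ g → g ∈⟨ f ⟩ × IsAShop g ×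
      Σ (Fin n) λ b → Σ (Subset n) λ B′ → Σ (Subset n) λ B″ →
        b ∉ B′ × b ∉ B″ × Empty (B′ ∩ B″) × (⁅ b ⁆ ∪ B′ ∪ B″) ≡ ⊤ ×
        Nonempty B′ ×
        g b ≡ ⊤ ×
        (∀ x → x ∈ B′ → g x ≡ ⁅ x ⁆) ×
        (∀ x → x ∈ B″ → ∃ λ y → y ∈ B′ × g x ≡ ⁅ y ⁆)
lemma3p5 (suc zero) (s≤s ()) _ _
lemma3p5 (suc (suc _)) _ f ((nonempty , _) , b , fb) =
  collapse , collapse∈⟨f⟩ , collapse-AShop ,
  b , B′ , B″ , b∉B′ , b∉B″ , B′∩B″-empty , b∪B′∪B″≡⊤ ,
  B′-nonempty (punchIn b Fin.zero , punchInᵢ≢i b Fin.zero) ,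
  collapse-b , collapse-B′ , collapse-B″
  where open Construction f nonempty b fb
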